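{- For all $e\geq 1$, the twisted Stern sequence satisfies $$\sum_{n=0}^{3\cdot 2^e} t(n)z^n=2z\sum_{j=0}^{e-1}(-1)^j\prod_{i=0}^{j-1}(1+z^{2^i}+z^{2^{i+1}})-(-1)^ez(z^{2^e}-1)\prod_{i=0}^{e-1} (1+z^{2^i}+z^{2^{i+1}}).$$
   Context: The twisted Stern sequence is defined by $t(0)=0$, $t(1)=1$, and for $n\ge1$, $t(2n)=-t(n)$, $t(2n+1)=-t(n)-t(n+1)$. An empty product equals $1$. -}

module Defs where

open import Data.Nat using (ℕ; zero; suc; _*_; _^_; ⌊_/2⌋)
open import Data.Bool using (Bool; true; false; if_then_else_)
open import Data.Integer as ℤ using (ℤ; +_; -_)
open import Data.List using (List; []; _∷_; map; replicate; _++_)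
open import Relation.Binary.PropositionalEquality using (_≡_)

-- The twisted Stern sequence
-- t(0)=0, t(1)=1, t(2n) = -t(n), t(2n+1) = -t(n) - t(n+1)  (n ≥ 1).
-- Implemented with a fuel argument (fuel n+1 is enough for argument n,
-- since the recursive arguments ⌊n/2⌋, ⌊n/2⌋+1 are < n for n ≥ 2).

isEven : ℕ → Bool
isEven zero = true
isEven (suc n) with isEven n
... | true = false
... | false = true

tF : ℕ → ℕ → ℤ
tF zero _ = + 0
tF (suc f) zero = + 0
tF (suc f) (suc zero) = + 1
tF (suc f) (suc (suc m)) =
  if isEven m
  then - tF f h
  else (- tF f h) ℤ.- tF f (suc h)
  where h = ⌊ suc (suc m) /2⌋

t : ℕ → ℤ
t n = tF (suc n) n

-- Polynomials in z with integer coefficients, as coefficient lists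
-- (index i = coefficient of z^i).  Equality is coefficientwise.

Poly : Set
Poly = List ℤ

coeff : Poly → ℕ → ℤ
coeff [] _ = + 0
coeff (a ∷ p) zero = a
coeff (a ∷ p) (suc k) = coeff p k

infixl 6 _+ₚ_ _-ₚ_
infixl 7 _*ₚ_ _·ₚ_
infix 4 _≈ₚ_

_+ₚ_ : Poly → Poly → Poly
[] +ₚ q = q
(a ∷ p) +ₚ [] = a ∷ p
(a ∷ p) +ₚ (b ∷ q) = (a ℤ.+ b) ∷ (p +ₚ q)

_·ₚ_ : ℤ → Poly → Poly
c ·ₚ p = map (c ℤ.*_) p

_-ₚ_ : Poly → Poly → Poly
p -ₚ q = p +ₚ ((- + 1) ·ₚ q)

_*ₚ_ : Poly → Poly → Poly
[] *ₚ q = []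
(a ∷ p) *ₚ q = (a ·ₚ q) +ₚ (+ 0 ∷ (p *ₚ q))

constₚ : ℤ → Poly
constₚ c = c ∷ []

Z^ : ℕ → Poly
Z^ n = replicate n (+ 0) ++ (+ 1 ∷ [])

Z : Poly
Z = Z^ 1

_≈ₚ_ : Poly → Poly → Set
p ≈ₚ q = ∀ k → coeff p k ≡ coeff q k

sumTo : ℕ → (ℕ → Poly) → Poly
sumTo zero f = f zero
sumTo (suc N) f = sumTo N f +ₚ f (suc N)

sumBelow : ℕ → (ℕ → Poly) → Poly
sumBelow zero f = []
sumBelow (suc e) f = sumBelow e f +ₚ f e

prodBelow : ℕ → (ℕ → Poly) → Poly
prodBelow zero f = constₚ (+ 1)
prodBelow (suc j) f = prodBelow j f *ₚ f j

sgn : ℕ → ℤ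
sgn zero = + 1
sgn (suc j) = - sgn j

factor : ℕ → Poly
factor i = constₚ (+ 1) +ₚ Z^ (2 ^ i) +ₚ Z^ (2 ^ suc i)

-- Write P_e = ∏_{i<e} (1 + z^{2^i} + z^{2^{i+1}}).  All identities are proved on coefficient
-- sequences ℕ → ℤ, on which multiplication by z^a is the shift operator.
--
-- Since P_{e+1}(z) = (1 + z + z²)·P_e(z²), the coefficients of z·P_{e+1} arise from those of
-- z·P_e by one "Stern step"  g(2j) = f(j), g(2j+1) = f(j) + f(j+1).  Stern steps are stable
-- under sums and under shifts (z^a becomes z^{2a}), so the coefficients R_e of z·(1 + z^{2^e})·P_e
-- also evolve by Stern steps.  The sequence t obeys the same recurrence up to the sign -1, so
-- induction on e gives the block formula  t(T_e + m) = (-1)^e R_e(m)  for 0 ≤ m ≤ T_e.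
--
-- Consequently the partial sum up to T_{e+1} = 2·T_e is the one up to T_e plus (-1)^e z^{T_e} R_e.
-- The coefficients H_e of the right-hand side satisfy the same recursion (an identity in
-- w = z^{2^e}) and agree with the partial sum for e = 0; this proves the lemma, in fact for all e.

module Submission where

open import Defs
open import Data.Nat as ℕ
  using (ℕ; zero; suc; _≤_; _<_; z≤n; s≤s; _^_; ⌊_/2⌋; compare; less; equal; greater)
open import Data.Nat.Properties as ℕP
  using (+-suc; +-comm; m≤m+n; ≤-trans; n≤1+n; <⇒≤; <⇒≱; ≰⇒>; ⌊n/2⌋≤n; ⌊n/2⌋<n; m^n>0)
import Data.Nat.Tactic.RingSolver as ℕSolver
open import Data.Integer using (ℤ; +_; -_; _+_; _-_; _*_)
open import Data.Integer.Properties
  using (+-identityˡ; +-identityʳ; *-zeroʳ; *-identityˡ; *-identityʳ; neg-distribˡ-*)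
open import Data.Integer.Tactic.RingSolver using (solve-∀)
open import Data.Bool using (true; false; if_then_else_)
open import Data.List using ([]; _∷_)
open import Relation.Nullary using (Dec; yes; no)
open import Relation.Nullary.Decidable using (does; dec-true; dec-false)
open import Relation.Binary.PropositionalEquality
  using (_≡_; _≗_; refl; sym; trans; cong; cong₂; subst; module ≡-Reasoning)

-- Multiplication by z^a on coefficient sequences: (shift a f) k = f (k - a), and 0 for k < a.
shift : ℕ → (ℕ → ℤ) → ℕ → ℤ
shift zero    f k       = f k
shift (suc a) f zero    = + 0
shift (suc a) f (suc k) = shift a f k

shift-cong : ∀ a {f g} → f ≗ g → shift a f ≗ shift a g
shift-cong zero    f≗g k       = f≗g k
shift-cong (suc a) f≗g zero    = refl
shift-cong (suc a) f≗g (suc k) = shift-cong a f≗g k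

shift-+ : ∀ a f g → shift a (λ i → f i + g i) ≗ λ k → shift a f k + shift a g k
shift-+ zero    f g k       = refl
shift-+ (suc a) f g zero    = refl
shift-+ (suc a) f g (suc k) = shift-+ a f g k

shift-scale : ∀ a c f → shift a (λ i → c * f i) ≗ λ k → c * shift a f k
shift-scale zero    c f k       = refl
shift-scale (suc a) c f zero    = sym (*-zeroʳ c)
shift-scale (suc a) c f (suc k) = shift-scale a c f k

shift-zero : ∀ a → shift a (λ _ → + 0) ≗ λ _ → + 0
shift-zero zero    k       = refl
shift-zero (suc a) zero    = refl
shift-zero (suc a) (suc k) = shift-zero a k

shift-shift : ∀ a b f → shift a (shift b f) ≗ shift (a ℕ.+ b) f
shift-shift zero    b f k       = refl
shift-shift (suc a) b f zero    = refl
shift-shift (suc a) b f (suc k) = shift-shift a b f k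

shift-comm : ∀ a b f → shift a (shift b f) ≗ shift b (shift a f)
shift-comm a b f k = begin
  shift a (shift b f) k ≡⟨ shift-shift a b f k ⟩
  shift (a ℕ.+ b) f k   ≡⟨ cong (λ c → shift c f k) (+-comm a b) ⟩
  shift (b ℕ.+ a) f k   ≡⟨ shift-shift b a f k ⟨
  shift b (shift a f) k ∎
  where open ≡-Reasoning

shift-below : ∀ a f k → k < a → shift a f k ≡ + 0
shift-below (suc a) f zero    _         = refl
shift-below (suc a) f (suc k) (s≤s k<a) = shift-below a f k k<a

shift-above : ∀ a f d → shift a f (a ℕ.+ d) ≡ f d
shift-above zero    f d = refl
shift-above (suc a) f d = shift-above a f d

shift-at-0 : ∀ a f → f 0 ≡ + 0 → shift a f 0 ≡ + 0
shift-at-0 zero    f f0 = f0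
shift-at-0 (suc a) f f0 = refl

coeff-+ : ∀ p q k → coeff (p +ₚ q) k ≡ coeff p k + coeff q k
coeff-+ []      q       k       = sym (+-identityˡ _)
coeff-+ (a ∷ p) []      k       = sym (+-identityʳ _)
coeff-+ (a ∷ p) (b ∷ q) zero    = refl
coeff-+ (a ∷ p) (b ∷ q) (suc k) = coeff-+ p q k

coeff-· : ∀ c p k → coeff (c ·ₚ p) k ≡ c * coeff p k
coeff-· c []      k       = sym (*-zeroʳ c)
coeff-· c (a ∷ p) zero    = refl
coeff-· c (a ∷ p) (suc k) = coeff-· c p k

coeff-0∷ : ∀ p → coeff (+ 0 ∷ p) ≗ shift 1 (coeff p)
coeff-0∷ p zero    = refl
coeff-0∷ p (suc k) = refl

coeff-*-∷ : ∀ a p q k → coeff ((a ∷ p) *ₚ q) k ≡ a * coeff q k + shift 1 (coeff (p *ₚ q)) k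
coeff-*-∷ a p q k = trans (coeff-+ (a ·ₚ q) _ k) (cong₂ _+_ (coeff-· a q k) (coeff-0∷ (p *ₚ q) k))

coeff-*-+ : ∀ p q r → coeff (p *ₚ (q +ₚ r)) ≗ λ k → coeff (p *ₚ q) k + coeff (p *ₚ r) k
coeff-*-+ []      q r k = refl
coeff-*-+ (a ∷ p) q r k = begin
  coeff ((a ∷ p) *ₚ (q +ₚ r)) k
    ≡⟨ coeff-*-∷ a p (q +ₚ r) k ⟩
  a * coeff (q +ₚ r) k + shift 1 (coeff (p *ₚ (q +ₚ r))) k
    ≡⟨ cong₂ _+_ (cong (a *_) (coeff-+ q r k))
                 (trans (shift-cong 1 (coeff-*-+ p q r) k) (shift-+ 1 _ _ k)) ⟩
  a * (coeff q k + coeff r k) + (shift 1 (coeff (p *ₚ q)) k + shift 1 (coeff (p *ₚ r)) k)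
    ≡⟨ distribute a _ _ _ _ ⟩
  (a * coeff q k + shift 1 (coeff (p *ₚ q)) k) + (a * coeff r k + shift 1 (coeff (p *ₚ r)) k)
    ≡⟨ cong₂ _+_ (coeff-*-∷ a p q k) (coeff-*-∷ a p r k) ⟨
  coeff ((a ∷ p) *ₚ q) k + coeff ((a ∷ p) *ₚ r) k ∎
  where
  open ≡-Reasoning
  distribute : ∀ a x y u v → a * (x + y) + (u + v) ≡ (a * x + u) + (a * y + v)
  distribute = solve-∀

coeff-+-* : ∀ p p′ q → coeff ((p +ₚ p′) *ₚ q) ≗ λ k → coeff (p *ₚ q) k + coeff (p′ *ₚ q) k
coeff-+-* []      p′       q k = sym (+-identityˡ _)
coeff-+-* (a ∷ p) []       q k = sym (+-identityʳ _)
coeff-+-* (a ∷ p) (b ∷ p′) q k = begin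
  coeff (((a ∷ p) +ₚ (b ∷ p′)) *ₚ q) k
    ≡⟨ coeff-*-∷ (a + b) (p +ₚ p′) q k ⟩
  (a + b) * coeff q k + shift 1 (coeff ((p +ₚ p′) *ₚ q)) k
    ≡⟨ cong (λ x → (a + b) * coeff q k + x) (trans (shift-cong 1 (coeff-+-* p p′ q) k) (shift-+ 1 _ _ k)) ⟩
  (a + b) * coeff q k + (shift 1 (coeff (p *ₚ q)) k + shift 1 (coeff (p′ *ₚ q)) k)
    ≡⟨ distribute a b _ _ _ ⟩
  (a * coeff q k + shift 1 (coeff (p *ₚ q)) k) + (b * coeff q k + shift 1 (coeff (p′ *ₚ q)) k)
    ≡⟨ cong₂ _+_ (coeff-*-∷ a p q k) (coeff-*-∷ b p′ q k) ⟨
  coeff ((a ∷ p) *ₚ q) k + coeff ((b ∷ p′) *ₚ q) k ∎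
  where
  open ≡-Reasoning
  distribute : ∀ a b x u v → (a + b) * x + (u + v) ≡ (a * x + u) + (b * x + v)
  distribute = solve-∀

coeff-·-* : ∀ c p q → coeff ((c ·ₚ p) *ₚ q) ≗ λ k → c * coeff (p *ₚ q) k
coeff-·-* c []      q k = sym (*-zeroʳ c)
coeff-·-* c (a ∷ p) q k = begin
  coeff ((c ·ₚ (a ∷ p)) *ₚ q) k
    ≡⟨ coeff-*-∷ (c * a) (c ·ₚ p) q k ⟩
  c * a * coeff q k + shift 1 (coeff ((c ·ₚ p) *ₚ q)) k
    ≡⟨ cong (λ x → c * a * coeff q k + x) (trans (shift-cong 1 (coeff-·-* c p q) k) (shift-scale 1 c _ k)) ⟩
  c * a * coeff q k + c * shift 1 (coeff (p *ₚ q)) k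
    ≡⟨ factor-out c a _ _ ⟩
  c * (a * coeff q k + shift 1 (coeff (p *ₚ q)) k)
    ≡⟨ cong (c *_) (coeff-*-∷ a p q k) ⟨
  c * coeff ((a ∷ p) *ₚ q) k ∎
  where
  open ≡-Reasoning
  factor-out : ∀ c a x u → c * a * x + c * u ≡ c * (a * x + u)
  factor-out = solve-∀

monomial-∷ : ∀ a p n k → a * coeff (Z^ n) k + shift (suc n) (coeff p) k ≡ shift n (coeff (a ∷ p)) k
monomial-∷ a p zero    zero    = trans (+-identityʳ _) (*-identityʳ a)
monomial-∷ a p zero    (suc k) = trans (cong (_+ coeff p k) (*-zeroʳ a)) (+-identityˡ _)
monomial-∷ a p (suc n) zero    = trans (+-identityʳ _) (*-zeroʳ a)
monomial-∷ a p (suc n) (suc k) = monomial-∷ a p n k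

coeff-*-Z^ : ∀ p n → coeff (p *ₚ Z^ n) ≗ shift n (coeff p)
coeff-*-Z^ []      n k = sym (shift-zero n k)
coeff-*-Z^ (a ∷ p) n k = begin
  coeff ((a ∷ p) *ₚ Z^ n) k                          ≡⟨ coeff-*-∷ a p (Z^ n) k ⟩
  a * coeff (Z^ n) k + shift 1 (coeff (p *ₚ Z^ n)) k ≡⟨ cong (λ x → a * coeff (Z^ n) k + x) shifted ⟩
  a * coeff (Z^ n) k + shift (suc n) (coeff p) k     ≡⟨ monomial-∷ a p n k ⟩
  shift n (coeff (a ∷ p)) k                          ∎
  where
  open ≡-Reasoning
  shifted : shift 1 (coeff (p *ₚ Z^ n)) k ≡ shift (suc n) (coeff p) k
  shifted = trans (shift-cong 1 (coeff-*-Z^ p n) k) (shift-shift 1 n (coeff p) k)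

coeff-Z^-* : ∀ n q → coeff (Z^ n *ₚ q) ≗ shift n (coeff q)
coeff-Z^-* zero q k = begin
  coeff (Z^ 0 *ₚ q) k                               ≡⟨ coeff-*-∷ (+ 1) [] q k ⟩
  + 1 * coeff q k + shift 1 (coeff ([] *ₚ q)) k     ≡⟨ cong (λ x → + 1 * coeff q k + x) (shift-zero 1 k) ⟩
  + 1 * coeff q k + + 0                             ≡⟨ trans (+-identityʳ _) (*-identityˡ _) ⟩
  coeff q k                                         ∎
  where open ≡-Reasoning
coeff-Z^-* (suc n) q k = begin
  coeff (Z^ (suc n) *ₚ q) k                          ≡⟨ coeff-*-∷ (+ 0) (Z^ n) q k ⟩
  + 0 * coeff q k + shift 1 (coeff (Z^ n *ₚ q)) k    ≡⟨ +-identityˡ _ ⟩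
  shift 1 (coeff (Z^ n *ₚ q)) k                      ≡⟨ shift-cong 1 (coeff-Z^-* n q) k ⟩
  shift 1 (shift n (coeff q)) k                      ≡⟨ shift-shift 1 n (coeff q) k ⟩
  shift (suc n) (coeff q) k                          ∎
  where open ≡-Reasoning

coeff-Z^-*-* : ∀ n p q → coeff ((Z^ n *ₚ p) *ₚ q) ≗ shift n (coeff (p *ₚ q))
coeff-Z^-*-* zero p q k = begin
  coeff (((+ 1 ·ₚ p) +ₚ (+ 0 ∷ [])) *ₚ q) k
    ≡⟨ coeff-+-* (+ 1 ·ₚ p) (+ 0 ∷ []) q k ⟩
  coeff ((+ 1 ·ₚ p) *ₚ q) k + coeff ((+ 0 ∷ []) *ₚ q) k
    ≡⟨ cong₂ _+_ (coeff-·-* (+ 1) p q k) (coeff-*-∷ (+ 0) [] q k) ⟩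
  + 1 * coeff (p *ₚ q) k + (+ 0 * coeff q k + shift 1 (coeff ([] *ₚ q)) k)
    ≡⟨ cong (λ x → + 1 * coeff (p *ₚ q) k + (+ 0 * coeff q k + x)) (shift-zero 1 k) ⟩
  + 1 * coeff (p *ₚ q) k + (+ 0 * coeff q k + + 0)
    ≡⟨ simplify (coeff (p *ₚ q) k) (coeff q k) ⟩
  coeff (p *ₚ q) k ∎
  where
  open ≡-Reasoning
  simplify : ∀ x y → + 1 * x + (+ 0 * y + + 0) ≡ x
  simplify = solve-∀
coeff-Z^-*-* (suc n) p q k = begin
  coeff (((+ 0 ·ₚ p) +ₚ (+ 0 ∷ (Z^ n *ₚ p))) *ₚ q) k
    ≡⟨ coeff-+-* (+ 0 ·ₚ p) (+ 0 ∷ (Z^ n *ₚ p)) q k ⟩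
  coeff ((+ 0 ·ₚ p) *ₚ q) k + coeff ((+ 0 ∷ (Z^ n *ₚ p)) *ₚ q) k
    ≡⟨ cong₂ _+_ (coeff-·-* (+ 0) p q k) (coeff-*-∷ (+ 0) (Z^ n *ₚ p) q k) ⟩
  + 0 * coeff (p *ₚ q) k + (+ 0 * coeff q k + shift 1 (coeff ((Z^ n *ₚ p) *ₚ q)) k)
    ≡⟨ simplify (coeff (p *ₚ q) k) (coeff q k) _ ⟩
  shift 1 (coeff ((Z^ n *ₚ p) *ₚ q)) k
    ≡⟨ shift-cong 1 (coeff-Z^-*-* n p q) k ⟩
  shift 1 (shift n (coeff (p *ₚ q))) k
    ≡⟨ shift-shift 1 n _ k ⟩
  shift (suc n) (coeff (p *ₚ q)) k ∎
  where
  open ≡-Reasoning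
  simplify : ∀ x y z → + 0 * x + (+ 0 * y + z) ≡ z
  simplify = solve-∀

-- Doubling, defined by recursion so that it computes on successors; parity is a view on it.
twice : ℕ → ℕ
twice zero    = zero
twice (suc n) = suc (suc (twice n))

twice-≡ : ∀ n → twice n ≡ n ℕ.+ n
twice-≡ zero    = refl
twice-≡ (suc n) = cong suc (trans (cong suc (twice-≡ n)) (sym (+-suc n n)))

twice-+ : ∀ m n → twice (m ℕ.+ n) ≡ twice m ℕ.+ twice n
twice-+ zero    n = refl
twice-+ (suc m) n = cong (λ x → suc (suc x)) (twice-+ m n)

n≤twice : ∀ n → n ≤ twice n
n≤twice zero    = z≤n
n≤twice (suc n) = s≤s (≤-trans (n≤twice n) (n≤1+n _))

data Parity : ℕ → Set where
  even : ∀ j → Parity (twice j)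
  odd  : ∀ j → Parity (suc (twice j))

parity : ∀ n → Parity n
parity zero = even zero
parity (suc n) with parity n
... | even j = odd j
... | odd j  = even (suc j)

twice-≤-cancel : ∀ {m n} → twice m ≤ twice n → m ≤ n
twice-≤-cancel {zero}          _              = z≤n
twice-≤-cancel {suc m} {suc n} (s≤s (s≤s le)) = s≤s (twice-≤-cancel le)

suc-twice-≤-twice : ∀ {m n} → suc (twice m) ≤ twice n → m < n
suc-twice-≤-twice {zero}  {suc n} _              = s≤s z≤n
suc-twice-≤-twice {suc m} {suc n} (s≤s (s≤s le)) = s≤s (suc-twice-≤-twice le)

twice-≤-suc-twice : ∀ {m n} → twice m ≤ suc (twice n) → m ≤ n
twice-≤-suc-twice {zero}          _              = z≤n
twice-≤-suc-twice {suc m} {zero}  (s≤s ())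
twice-≤-suc-twice {suc m} {suc n} (s≤s (s≤s le)) = s≤s (twice-≤-suc-twice le)

-- The fuel of Defs.tF is irrelevant once it exceeds the argument: the recursive arguments
-- ⌊n/2⌋ and ⌊n/2⌋ + 1 stay below it.
tF-fuel : ∀ {f g n} → n < f → n < g → tF f n ≡ tF g n
tF-fuel {suc f} {suc g} {zero}              _       _       = refl
tF-fuel {suc f} {suc g} {suc zero}          _       _       = refl
tF-fuel {suc f} {suc g} {suc (suc zero)}    (s≤s p) (s≤s q) = cong -_ (tF-fuel p q)
tF-fuel {suc f} {suc g} {suc (suc (suc m))} (s≤s p) (s≤s q) =
  cong₂ (λ a b → if isEven (suc m) then - a else - a - b)
        (tF-fuel (≤-trans half<n p) (≤-trans half<n q))
        (tF-fuel (≤-trans half+1<n p) (≤-trans half+1<n q))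
  where
  half<n : suc (suc ⌊ suc m /2⌋) ≤ suc (suc (suc m))
  half<n = s≤s (s≤s (⌊n/2⌋≤n (suc m)))
  half+1<n : suc (suc (suc ⌊ suc m /2⌋)) ≤ suc (suc (suc m))
  half+1<n = s≤s (s≤s (⌊n/2⌋<n m))

t-fuel : ∀ {f n} → n < f → tF f n ≡ t n
t-fuel {n = n} n<f = tF-fuel n<f (ℕP.n<1+n n)

isEven-twice : ∀ n → isEven (twice n) ≡ true
isEven-twice zero = refl
isEven-twice (suc n) rewrite isEven-twice n = refl

isEven-suc-twice : ∀ n → isEven (suc (twice n)) ≡ false
isEven-suc-twice n rewrite isEven-twice n = refl

half-twice : ∀ n → ⌊ twice n /2⌋ ≡ n
half-twice zero    = refl
half-twice (suc n) = cong suc (half-twice n)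

half-suc-twice : ∀ n → ⌊ suc (twice n) /2⌋ ≡ n
half-suc-twice zero    = refl
half-suc-twice (suc n) = cong suc (half-suc-twice n)

t-twice : ∀ n → 1 ≤ n → t (twice n) ≡ - t n
t-twice (suc n) _ rewrite isEven-twice n | half-twice n =
  cong -_ (t-fuel (s≤s (s≤s (n≤twice n))))

t-suc-twice : ∀ n → 1 ≤ n → t (suc (twice n)) ≡ - t n - t (suc n)
t-suc-twice (suc n) _ rewrite isEven-suc-twice n | half-suc-twice n =
  cong₂ (λ a b → - a - b) (t-fuel (s≤s (s≤s (≤-trans (n≤twice n) (n≤1+n _)))))
                          (t-fuel (s≤s (s≤s (s≤s (n≤twice n)))))

-- g arises from f by one Stern step; for f the coefficients of z·F(z) with f 0 = 0,
-- g are the coefficients of z·(1 + z + z²)·F(z²).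
record SternStep (f g : ℕ → ℤ) : Set where
  field
    even-step : ∀ j → g (twice j) ≡ f j
    odd-step  : ∀ j → g (suc (twice j)) ≡ f j + f (suc j)
open SternStep

SternStep-cong : ∀ {f f′ g g′} → f ≗ f′ → g ≗ g′ → SternStep f g → SternStep f′ g′
SternStep-cong f≗f′ g≗g′ st = record
  { even-step = λ j → trans (sym (g≗g′ (twice j))) (trans (even-step st j) (f≗f′ j))
  ; odd-step  = λ j → trans (sym (g≗g′ (suc (twice j))))
                            (trans (odd-step st j) (cong₂ _+_ (f≗f′ j) (f≗f′ (suc j))))
  }

SternStep-+ : ∀ {f g f′ g′} → SternStep f g → SternStep f′ g′ →
              SternStep (λ k → f k + f′ k) (λ k → g k + g′ k)
SternStep-+ {f = f} {f′ = f′} st st′ = record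
  { even-step = λ j → cong₂ _+_ (even-step st j) (even-step st′ j)
  ; odd-step  = λ j → trans (cong₂ _+_ (odd-step st j) (odd-step st′ j))
                            (interchange (f j) (f (suc j)) (f′ j) (f′ (suc j)))
  }
  where
  interchange : ∀ a b c d → (a + b) + (c + d) ≡ (a + c) + (b + d)
  interchange = solve-∀

SternStep-shift : ∀ {f g} → f 0 ≡ + 0 → SternStep f g → ∀ a → SternStep (shift a f) (shift (twice a) g)
SternStep-shift f0 st zero    = st
SternStep-shift {f} {g} f0 st (suc a) = record
  { even-step = λ { zero → refl ; (suc j) → even-step shifted j }
  ; odd-step  = λ { zero → sym (trans (+-identityˡ _) (shift-at-0 a f f0))
                  ; (suc j) → odd-step shifted j }
  }
  where
  shifted : SternStep (shift a f) (shift (twice a) g)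
  shifted = SternStep-shift f0 st a

SternStep-vanish : ∀ {f g} D → SternStep f g → (∀ m → D ≤ m → f m ≡ + 0) →
                   ∀ m → twice D ≤ m → g m ≡ + 0
SternStep-vanish D st van m le with parity m
... | even j = trans (even-step st j) (van j (twice-≤-cancel le))
... | odd j  = trans (odd-step st j)
                     (cong₂ _+_ (van j D≤j) (van (suc j) (≤-trans D≤j (n≤1+n j))))
  where
  D≤j : D ≤ j
  D≤j = twice-≤-suc-twice le

pow2-suc : ∀ e → 2 ^ suc e ≡ twice (2 ^ e)
pow2-suc e = trans (double (2 ^ e)) (sym (twice-≡ (2 ^ e)))
  where
  double : ∀ w → 2 ℕ.* w ≡ w ℕ.+ w
  double = ℕSolver.solve-∀

SternStep-shift-pow2 : ∀ {f g} → f 0 ≡ + 0 → SternStep f g →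
                       ∀ i → SternStep (shift (2 ^ i) f) (shift (2 ^ suc i) g)
SternStep-shift-pow2 {f} {g} f0 st i =
  subst (λ a → SternStep (shift (2 ^ i) f) (shift a g)) (sym (pow2-suc i)) (SternStep-shift f0 st (2 ^ i))

P : ℕ → ℕ → ℤ
P e = coeff (prodBelow e factor)

P-rec : ∀ e → P (suc e) ≗ λ k → P e k + shift (2 ^ e) (P e) k + shift (2 ^ suc e) (P e) k
P-rec e k = begin
  coeff (Pₑ *ₚ ((Z^ 0 +ₚ Z^ (2 ^ e)) +ₚ Z^ (2 ^ suc e))) k
    ≡⟨ coeff-*-+ Pₑ _ _ k ⟩
  coeff (Pₑ *ₚ (Z^ 0 +ₚ Z^ (2 ^ e))) k + coeff (Pₑ *ₚ Z^ (2 ^ suc e)) k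
    ≡⟨ cong₂ _+_ (coeff-*-+ Pₑ _ _ k) (coeff-*-Z^ Pₑ _ k) ⟩
  coeff (Pₑ *ₚ Z^ 0) k + coeff (Pₑ *ₚ Z^ (2 ^ e)) k + shift (2 ^ suc e) (P e) k
    ≡⟨ cong (_+ shift (2 ^ suc e) (P e) k) (cong₂ _+_ (coeff-*-Z^ Pₑ 0 k) (coeff-*-Z^ Pₑ _ k)) ⟩
  P e k + shift (2 ^ e) (P e) k + shift (2 ^ suc e) (P e) k ∎
  where
  open ≡-Reasoning
  Pₑ : Poly
  Pₑ = prodBelow e factor

-- The coefficients of z·P_e; multiplying by z makes U e 0 = 0, as required for shifting Stern steps.
U : ℕ → ℕ → ℤ
U e = shift 1 (P e)

U-rec : ∀ e → U (suc e) ≗ λ k → U e k + shift (2 ^ e) (U e) k + shift (2 ^ suc e) (U e) k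
U-rec e k = begin
  shift 1 (P (suc e)) k
    ≡⟨ shift-cong 1 (P-rec e) k ⟩
  shift 1 (λ i → P e i + shift w (P e) i + shift W (P e) i) k
    ≡⟨ shift-+ 1 _ _ k ⟩
  shift 1 (λ i → P e i + shift w (P e) i) k + shift 1 (shift W (P e)) k
    ≡⟨ cong (_+ shift 1 (shift W (P e)) k) (shift-+ 1 _ _ k) ⟩
  U e k + shift 1 (shift w (P e)) k + shift 1 (shift W (P e)) k
    ≡⟨ cong₂ (λ x y → U e k + x + y) (shift-comm 1 w (P e) k) (shift-comm 1 W (P e) k) ⟩
  U e k + shift w (U e) k + shift W (U e) k ∎
  where
  open ≡-Reasoning
  w W : ℕ
  w = 2 ^ e
  W = 2 ^ suc e

U-stern : ∀ e → SternStep (U e) (U (suc e))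
U-stern zero = record { even-step = even₀ ; odd-step = odd₀ }
  where
  even₀ : ∀ j → U 1 (twice j) ≡ U 0 j
  even₀ zero          = refl
  even₀ (suc zero)    = refl
  even₀ (suc (suc j)) = refl
  odd₀ : ∀ j → U 1 (suc (twice j)) ≡ U 0 j + U 0 (suc j)
  odd₀ zero          = refl
  odd₀ (suc zero)    = refl
  odd₀ (suc (suc j)) = refl
U-stern (suc e) =
  SternStep-cong (λ k → sym (U-rec e k)) (λ k → sym (U-rec (suc e) k))
    (SternStep-+ (SternStep-+ stₑ (SternStep-shift-pow2 refl stₑ e))
                 (SternStep-shift-pow2 refl stₑ (suc e)))
  where
  stₑ : SternStep (U e) (U (suc e))
  stₑ = U-stern e

-- The coefficients of z·(1 + z^{2^e})·P_e, which describe the block of t beyond T_e.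
R : ℕ → ℕ → ℤ
R e k = U e k + shift (2 ^ e) (U e) k

R-stern : ∀ e → SternStep (R e) (R (suc e))
R-stern e = SternStep-+ (U-stern e) (SternStep-shift-pow2 refl (U-stern e) e)

R-0 : ∀ e → R e 0 ≡ + 0
R-0 e = trans (+-identityˡ _) (shift-at-0 (2 ^ e) (U e) refl)

T : ℕ → ℕ
T e = 3 ℕ.* 2 ^ e

T-suc : ∀ e → T (suc e) ≡ twice (T e)
T-suc e = trans (swap (2 ^ e)) (sym (twice-≡ (T e)))
  where
  swap : ∀ w → 3 ℕ.* (2 ℕ.* w) ≡ 3 ℕ.* w ℕ.+ 3 ℕ.* w
  swap = ℕSolver.solve-∀

T-pos : ∀ e → 1 ≤ T e
T-pos e = ≤-trans (m^n>0 2 e) (m≤m+n (2 ^ e) _)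

R-vanish : ∀ e m → T e ≤ m → R e m ≡ + 0
R-vanish zero zero ()
R-vanish zero (suc zero) (s≤s ())
R-vanish zero (suc (suc zero)) (s≤s (s≤s ()))
R-vanish zero (suc (suc (suc m))) _ = refl
R-vanish (suc e) m le = SternStep-vanish (T e) (R-stern e) (R-vanish e) m (subst (_≤ m) (T-suc e) le)

-- The block formula: t(T_e + m) = (-1)^e R_e(m) for 0 ≤ m ≤ T_e.  Both sides obey the
-- recurrence of a Stern step (with sign -1) when passing from e to e + 1.
block : ∀ e m → m ≤ T e → t (T e ℕ.+ m) ≡ sgn e * R e m
block zero zero _ = refl
block zero (suc zero) _ = refl
block zero (suc (suc zero)) _ = refl
block zero (suc (suc (suc zero))) _ = refl
block zero (suc (suc (suc (suc m)))) (s≤s (s≤s (s≤s ())))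
block (suc e) m le with parity m
... | even j = begin
  t (T (suc e) ℕ.+ twice j)     ≡⟨ cong t (trans (cong (ℕ._+ twice j) (T-suc e)) (sym (twice-+ (T e) j))) ⟩
  t (twice (T e ℕ.+ j))         ≡⟨ t-twice (T e ℕ.+ j) (≤-trans (T-pos e) (m≤m+n (T e) j)) ⟩
  - t (T e ℕ.+ j)               ≡⟨ cong -_ (block e j (twice-≤-cancel le′)) ⟩
  - (sgn e * R e j)             ≡⟨ neg-distribˡ-* (sgn e) (R e j) ⟩
  - sgn e * R e j               ≡⟨ cong (- sgn e *_) (even-step (R-stern e) j) ⟨
  - sgn e * R (suc e) (twice j) ∎
  where
  open ≡-Reasoning
  le′ : twice j ≤ twice (T e)
  le′ = subst (twice j ≤_) (T-suc e) le
... | odd j = begin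
  t (T (suc e) ℕ.+ suc (twice j))
    ≡⟨ cong t index ⟩
  t (suc (twice (T e ℕ.+ j)))
    ≡⟨ t-suc-twice (T e ℕ.+ j) (≤-trans (T-pos e) (m≤m+n (T e) j)) ⟩
  - t (T e ℕ.+ j) - t (suc (T e ℕ.+ j))
    ≡⟨ cong₂ (λ a b → - a - b) (block e j (<⇒≤ j<T))
                               (trans (cong t (sym (+-suc (T e) j))) (block e (suc j) j<T)) ⟩
  - (sgn e * R e j) - sgn e * R e (suc j)
    ≡⟨ collect (sgn e) (R e j) (R e (suc j)) ⟩
  - sgn e * (R e j + R e (suc j))
    ≡⟨ cong (- sgn e *_) (odd-step (R-stern e) j) ⟨
  - sgn e * R (suc e) (suc (twice j)) ∎
  where
  open ≡-Reasoning
  index : T (suc e) ℕ.+ suc (twice j) ≡ suc (twice (T e ℕ.+ j))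
  index = begin
    T (suc e) ℕ.+ suc (twice j)      ≡⟨ cong (ℕ._+ suc (twice j)) (T-suc e) ⟩
    twice (T e) ℕ.+ suc (twice j)    ≡⟨ +-suc (twice (T e)) (twice j) ⟩
    suc (twice (T e) ℕ.+ twice j)    ≡⟨ cong suc (twice-+ (T e) j) ⟨
    suc (twice (T e ℕ.+ j))          ∎
  j<T : j < T e
  j<T = suc-twice-≤-twice (subst (suc (twice j) ≤_) (T-suc e) le)
  collect : ∀ s a b → - (s * a) - s * b ≡ - s * (a + b)
  collect = solve-∀

-- The truncation of f to indices ≤ N: the coefficient sequence of Σ_{n ≤ N} f(n) z^n.
trunc : ℕ → (ℕ → ℤ) → ℕ → ℤ
trunc N f k = if does (k ℕ.≤? N) then f k else + 0

trunc-in : ∀ {N k} f → k ≤ N → trunc N f k ≡ f k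
trunc-in {N} {k} f k≤N rewrite dec-true (k ℕ.≤? N) k≤N = refl

trunc-out : ∀ {N k} f → N < k → trunc N f k ≡ + 0
trunc-out {N} {k} f N<k rewrite dec-false (k ℕ.≤? N) (<⇒≱ N<k) = refl

trunc-extend : ∀ N M f g → g 0 ≡ + 0 →
               (∀ m → suc m ≤ M → f (N ℕ.+ suc m) ≡ g (suc m)) →
               (∀ m → M < m → g m ≡ + 0) →
               ∀ k → trunc N f k + shift N g k ≡ trunc (N ℕ.+ M) f k
trunc-extend N M f g g0 agree vanish k with compare k N
... | less k d = begin
  trunc N f k + shift N g k ≡⟨ cong₂ _+_ (trunc-in f k≤N) (shift-below N g k (s≤s (m≤m+n k d))) ⟩
  f k + + 0                 ≡⟨ +-identityʳ (f k) ⟩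
  f k                       ≡⟨ trunc-in f (≤-trans k≤N (m≤m+n N M)) ⟨
  trunc (N ℕ.+ M) f k       ∎
  where
  open ≡-Reasoning
  k≤N : k ≤ N
  k≤N = ≤-trans (m≤m+n k d) (n≤1+n _)
... | equal k = begin
  trunc k f k + shift k g k ≡⟨ cong₂ _+_ (trunc-in f ℕP.≤-refl) at-k ⟩
  f k + + 0                 ≡⟨ +-identityʳ (f k) ⟩
  f k                       ≡⟨ trunc-in f (m≤m+n k M) ⟨
  trunc (k ℕ.+ M) f k       ∎
  where
  open ≡-Reasoning
  at-k : shift k g k ≡ + 0
  at-k = trans (cong (shift k g) (sym (ℕP.+-identityʳ k))) (trans (shift-above k g 0) g0)
... | greater N d = trans beyond-N (tail (suc d ℕ.≤? M))
  where
  k≡ : N ℕ.+ suc d ≡ suc (N ℕ.+ d)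
  k≡ = +-suc N d
  beyond-N : trunc N f (suc (N ℕ.+ d)) + shift N g (suc (N ℕ.+ d)) ≡ g (suc d)
  beyond-N = trans (cong₂ _+_ (trunc-out f (s≤s (m≤m+n N d)))
                              (trans (cong (shift N g) (sym k≡)) (shift-above N g (suc d))))
                   (+-identityˡ _)
  tail : Dec (suc d ≤ M) → g (suc d) ≡ trunc (N ℕ.+ M) f (suc (N ℕ.+ d))
  tail (yes d<M) = begin
    g (suc d)                           ≡⟨ agree d d<M ⟨
    f (N ℕ.+ suc d)                     ≡⟨ cong f k≡ ⟩
    f (suc (N ℕ.+ d))                   ≡⟨ trunc-in f (subst (_≤ N ℕ.+ M) k≡ (ℕP.+-monoʳ-≤ N d<M)) ⟨
    trunc (N ℕ.+ M) f (suc (N ℕ.+ d))   ∎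
    where open ≡-Reasoning
  tail (no d≮M) = begin
    g (suc d)                           ≡⟨ vanish (suc d) (≰⇒> d≮M) ⟩
    + 0                                 ≡⟨ trunc-out f (subst (N ℕ.+ M <_) k≡ (ℕP.+-monoʳ-< N (≰⇒> d≮M))) ⟨
    trunc (N ℕ.+ M) f (suc (N ℕ.+ d))   ∎
    where open ≡-Reasoning

coeff-·-Z^-suc : ∀ c n → coeff (c ·ₚ Z^ (suc n)) ≗ shift n (coeff (c ·ₚ Z))
coeff-·-Z^-suc c zero    k       = refl
coeff-·-Z^-suc c (suc n) zero    = *-zeroʳ c
coeff-·-Z^-suc c (suc n) (suc k) = coeff-·-Z^-suc c n k

lhs-coeff : ∀ N f → coeff (sumTo N (λ n → f n ·ₚ Z^ n)) ≗ trunc N f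
lhs-coeff zero    f zero    = *-identityʳ (f 0)
lhs-coeff zero    f (suc k) = refl
lhs-coeff (suc N) f k = begin
  coeff (sumTo N (λ n → f n ·ₚ Z^ n) +ₚ (c ·ₚ Z^ (suc N))) k
    ≡⟨ coeff-+ (sumTo N (λ n → f n ·ₚ Z^ n)) (c ·ₚ Z^ (suc N)) k ⟩
  coeff (sumTo N (λ n → f n ·ₚ Z^ n)) k + coeff (c ·ₚ Z^ (suc N)) k
    ≡⟨ cong₂ _+_ (lhs-coeff N f k) (coeff-·-Z^-suc c N k) ⟩
  trunc N f k + shift N (coeff (c ·ₚ Z)) k
    ≡⟨ trunc-extend N 1 f (coeff (c ·ₚ Z)) (*-zeroʳ c) agree vanish k ⟩
  trunc (N ℕ.+ 1) f k
    ≡⟨ cong (λ M → trunc M f k) (+-comm N 1) ⟩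
  trunc (suc N) f k ∎
  where
  open ≡-Reasoning
  c : ℤ
  c = f (suc N)
  agree : ∀ m → suc m ≤ 1 → f (N ℕ.+ suc m) ≡ coeff (c ·ₚ Z) (suc m)
  agree zero    _               = trans (cong f (+-comm N 1)) (sym (*-identityʳ c))
  agree (suc m) (s≤s ())
  vanish : ∀ m → 1 < m → coeff (c ·ₚ Z) m ≡ + 0
  vanish (suc zero)    (s≤s ())
  vanish (suc (suc m)) _        = refl

RHS : ℕ → Poly
RHS e = ((+ 2) ·ₚ Z) *ₚ sumBelow e (λ j → sgn j ·ₚ prodBelow j factor)
        -ₚ sgn e ·ₚ (Z *ₚ (Z^ (2 ^ e) -ₚ constₚ (+ 1)) *ₚ prodBelow e factor)

S : ℕ → ℕ → ℤ
S e = coeff (sumBelow e (λ j → sgn j ·ₚ prodBelow j factor))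

V : ℕ → ℕ → ℤ
V e = shift 1 (S e)

V-rec : ∀ e → V (suc e) ≗ λ k → V e k + sgn e * U e k
V-rec e k = begin
  shift 1 (S (suc e)) k                        ≡⟨ shift-cong 1 S-rec k ⟩
  shift 1 (λ i → S e i + sgn e * P e i) k      ≡⟨ shift-+ 1 (S e) _ k ⟩
  V e k + shift 1 (λ i → sgn e * P e i) k      ≡⟨ cong (λ x → V e k + x) (shift-scale 1 (sgn e) (P e) k) ⟩
  V e k + sgn e * U e k                        ∎
  where
  open ≡-Reasoning
  S-rec : S (suc e) ≗ λ i → S e i + sgn e * P e i
  S-rec i = trans (coeff-+ (sumBelow e _) (sgn e ·ₚ prodBelow e factor) i)
                  (cong (λ x → S e i + x) (coeff-· (sgn e) (prodBelow e factor) i))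

H : ℕ → ℕ → ℤ
H e k = + 2 * V e k - sgn e * (shift (2 ^ e) (U e) k - U e k)

coeff-XP : ∀ e → coeff ((Z^ (2 ^ e) -ₚ constₚ (+ 1)) *ₚ prodBelow e factor) ≗
                 λ i → shift (2 ^ e) (P e) i + - + 1 * P e i
coeff-XP e i = trans (coeff-+-* (Z^ (2 ^ e)) ((- + 1) ·ₚ Z^ 0) Pₑ i)
                     (cong₂ _+_ (coeff-Z^-* (2 ^ e) Pₑ i)
                                (trans (coeff-·-* (- + 1) (Z^ 0) Pₑ i) (cong (- + 1 *_) (coeff-Z^-* 0 Pₑ i))))
  where
  Pₑ : Poly
  Pₑ = prodBelow e factor

rhs-coeff : ∀ e → coeff (RHS e) ≗ H e
rhs-coeff e k = begin
  coeff (RHS e) k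
    ≡⟨ coeff-+ A ((- + 1) ·ₚ (sgn e ·ₚ B)) k ⟩
  coeff A k + coeff ((- + 1) ·ₚ (sgn e ·ₚ B)) k
    ≡⟨ cong₂ _+_ coeff-A coeff-B ⟩
  + 2 * V e k + - + 1 * (sgn e * (shift w (U e) k + - + 1 * U e k))
    ≡⟨ tidy (V e k) (sgn e) (shift w (U e) k) (U e k) ⟩
  H e k ∎
  where
  open ≡-Reasoning
  w : ℕ
  w = 2 ^ e
  Σₑ X Pₑ A B : Poly
  Σₑ = sumBelow e (λ j → sgn j ·ₚ prodBelow j factor)
  X  = Z^ w -ₚ constₚ (+ 1)
  Pₑ = prodBelow e factor
  A  = ((+ 2) ·ₚ Z) *ₚ Σₑ
  B  = Z *ₚ X *ₚ Pₑ
  coeff-A : coeff A k ≡ + 2 * V e k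
  coeff-A = trans (coeff-·-* (+ 2) Z Σₑ k) (cong (+ 2 *_) (coeff-Z^-* 1 Σₑ k))
  coeff-ZXP : coeff B k ≡ shift w (U e) k + - + 1 * U e k
  coeff-ZXP = begin
    coeff B k                                                ≡⟨ coeff-Z^-*-* 1 X Pₑ k ⟩
    shift 1 (coeff (X *ₚ Pₑ)) k                              ≡⟨ shift-cong 1 (coeff-XP e) k ⟩
    shift 1 (λ i → shift w (P e) i + - + 1 * P e i) k        ≡⟨ shift-+ 1 (shift w (P e)) _ k ⟩
    shift 1 (shift w (P e)) k + shift 1 (λ i → - + 1 * P e i) k
      ≡⟨ cong₂ _+_ (shift-comm 1 w (P e) k) (shift-scale 1 (- + 1) (P e) k) ⟩
    shift w (U e) k + - + 1 * U e k                          ∎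
  coeff-B : coeff ((- + 1) ·ₚ (sgn e ·ₚ B)) k ≡ - + 1 * (sgn e * (shift w (U e) k + - + 1 * U e k))
  coeff-B = trans (coeff-· (- + 1) (sgn e ·ₚ B) k)
                  (cong (- + 1 *_) (trans (coeff-· (sgn e) B k) (cong (sgn e *_) coeff-ZXP)))
  tidy : ∀ v s a u → + 2 * v + - + 1 * (s * (a + - + 1 * u)) ≡ + 2 * v - s * (a - u)
  tidy = solve-∀

-- H_{e+1} = H_e + (-1)^e z^{T_e} R_e: with w = z^{2^e} this is the identity
-- 2 + (w² - 1)(1 + w + w²) + (w - 1) = w³(1 + w), using z^{T_e} = w³.
H-step : ∀ e → H (suc e) ≗ λ k → H e k + sgn e * shift (T e) (R e) k
H-step e k = begin
  + 2 * V (suc e) k - - s * (shift W (U (suc e)) k - U (suc e) k)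
    ≡⟨ cong₂ (λ x y → + 2 * x - - s * y) (V-rec e k) (cong₂ _-_ shiftW-U (U-rec e k)) ⟩
  + 2 * (V e k + s * u) - - s * ((b + c + d) - (u + a + b))
    ≡⟨ regroup (V e k) s u a b c d ⟩
  H e k + s * (c + d)
    ≡⟨ cong (λ x → H e k + s * x) shiftT-R ⟨
  H e k + s * shift (T e) (R e) k ∎
  where
  open ≡-Reasoning
  s : ℤ
  s = sgn e
  w W : ℕ
  w = 2 ^ e
  W = 2 ^ suc e
  u a b c d : ℤ
  u = U e k
  a = shift w (U e) k
  b = shift W (U e) k
  c = shift (T e) (U e) k
  d = shift (T e ℕ.+ w) (U e) k
  W+w : W ℕ.+ w ≡ T e
  W+w = arith w
    where
    arith : ∀ w → 2 ℕ.* w ℕ.+ w ≡ 3 ℕ.* w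
    arith = ℕSolver.solve-∀
  W+W : W ℕ.+ W ≡ T e ℕ.+ w
  W+W = arith w
    where
    arith : ∀ w → 2 ℕ.* w ℕ.+ 2 ℕ.* w ≡ 3 ℕ.* w ℕ.+ w
    arith = ℕSolver.solve-∀
  shiftW-U : shift W (U (suc e)) k ≡ b + c + d
  shiftW-U = begin
    shift W (U (suc e)) k
      ≡⟨ shift-cong W (U-rec e) k ⟩
    shift W (λ i → U e i + shift w (U e) i + shift W (U e) i) k
      ≡⟨ shift-+ W _ (shift W (U e)) k ⟩
    shift W (λ i → U e i + shift w (U e) i) k + shift W (shift W (U e)) k
      ≡⟨ cong₂ _+_ (shift-+ W (U e) (shift w (U e)) k) (shift-shift W W (U e) k) ⟩
    b + shift W (shift w (U e)) k + shift (W ℕ.+ W) (U e) k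
      ≡⟨ cong₂ (λ x y → b + x + y) (trans (shift-shift W w (U e) k) (cong (λ n → shift n (U e) k) W+w))
                                   (cong (λ n → shift n (U e) k) W+W) ⟩
    b + c + d ∎
  shiftT-R : shift (T e) (R e) k ≡ c + d
  shiftT-R = trans (shift-+ (T e) (U e) (shift w (U e)) k)
                   (cong (λ x → c + x) (shift-shift (T e) w (U e) k))
  regroup : ∀ v s u a b c d →
            + 2 * (v + s * u) - - s * ((b + c + d) - (u + a + b)) ≡ (+ 2 * v - s * (a - u)) + s * (c + d)
  regroup = solve-∀

-- The partial sums up to T_e have coefficients H_e: computed for e = 0, and for e + 1
-- the block formula extends the truncation from T_e to 2·T_e exactly as H-step extends H.
partial-sums : ∀ e → trunc (T e) t ≗ H e
partial-sums zero zero                      = refl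
partial-sums zero (suc zero)                = refl
partial-sums zero (suc (suc zero))          = refl
partial-sums zero (suc (suc (suc zero)))    = refl
partial-sums zero (suc (suc (suc (suc k)))) = refl
partial-sums (suc e) k = begin
  trunc (T (suc e)) t k
    ≡⟨ cong (λ N → trunc N t k) (trans (T-suc e) (twice-≡ (T e))) ⟩
  trunc (T e ℕ.+ T e) t k
    ≡⟨ trunc-extend (T e) (T e) t g g0 (λ m → block e (suc m)) vanish k ⟨
  trunc (T e) t k + shift (T e) g k
    ≡⟨ cong₂ _+_ (partial-sums e k) (shift-scale (T e) (sgn e) (R e) k) ⟩
  H e k + sgn e * shift (T e) (R e) k
    ≡⟨ H-step e k ⟨
  H (suc e) k ∎
  where
  open ≡-Reasoning
  g : ℕ → ℤ
  g m = sgn e * R e m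
  g0 : g 0 ≡ + 0
  g0 = trans (cong (sgn e *_) (R-0 e)) (*-zeroʳ (sgn e))
  vanish : ∀ m → T e < m → g m ≡ + 0
  vanish m lt = trans (cong (sgn e *_) (R-vanish e m (<⇒≤ lt))) (*-zeroʳ (sgn e))

lemma2p5 : (e : ℕ) → e ℕ.≥ 1 →
    sumTo (3 ℕ.* 2 ^ e) (λ n → t n ·ₚ Z^ n)
    ≈ₚ ((+ 2) ·ₚ Z) *ₚ sumBelow e (λ j → sgn j ·ₚ prodBelow j factor)
    -ₚ sgn e ·ₚ (Z *ₚ (Z^ (2 ^ e) -ₚ constₚ (+ 1)) *ₚ prodBelow e factor)
lemma2p5 e _ k = begin
  coeff (sumTo (T e) (λ n → t n ·ₚ Z^ n)) k ≡⟨ lhs-coeff (T e) t k ⟩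
  trunc (T e) t k                           ≡⟨ partial-sums e k ⟩
  H e k                                     ≡⟨ rhs-coeff e k ⟨
  coeff (RHS e) k                           ∎
  where open ≡-Reasoning
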